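{- Let $\mathcal{T}=(\mathcal{V},\mathcal{E})$ be a finite tree with geodesic distance $\mathcal{S}$, and let $m\ge 1$ be an integer. Let $\mathcal{T}^{\odot}$ be the $m$-vertex-operation tree of $\mathcal{T}$. Then the geodesic distance $\mathcal{S}^{\odot}$ of $\mathcal{T}^{\odot}$ is $$\mathcal{S}^{\odot}=(1+m)^{2}\mathcal{S}+m(m+1)|\mathcal{V}|^{2}-m|\mathcal{V}|.$$
   Context: For a connected finite graph $G$, its geodesic distance is $\mathcal{S}(G)=\sum_{\{u,v\}} d_G(u,v)$, the sum of the shortest-path distances over all unordered pairs of distinct vertices of $G$. The $m$-vertex-operation graph of a graph $G=(\mathcal{V},\mathcal{E})$ is obtained by attaching, to every vertex $u\in\mathcal{V}$, $m$ new pendant vertices, each joined by an edge to $u$ only (all new vertices distinct). -}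

module Defs where

open import Data.Nat using (ℕ; zero; suc; _+_; _*_; _≤_)
open import Data.Fin using (Fin)
open import Data.Nat.ListAction using (sum)
open import Data.List using (List; []; _∷_; _++_; [_]; map; length; allFin; cartesianProduct)
open import Data.List.Relation.Unary.Linked using (Linked)
open import Data.List.Relation.Unary.Unique.Propositional using (Unique)
open import Data.Product using (_×_; _,_; ∃; Σ)
open import Data.Sum using (_⊎_; inj₁; inj₂)
open import Data.Empty using (⊥)
open import Relation.Nullary using (¬_)
open import Relation.Binary.PropositionalEquality using (_≡_)

data Walk {V : Set} (A : V → V → Set) : V → V → ℕ → Set where
  here : ∀ {u} → Walk A u u 0
  step : ∀ {u w v k} → A u w → Walk A w v k → Walk A u v (suc k)

IsSimpleGraph : {V : Set} → (V → V → Set) → Set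
IsSimpleGraph {V} A = (∀ u v → A u v → A v u) × (∀ u → ¬ A u u)

Connected : {V : Set} → (V → V → Set) → Set
Connected {V} A = ∀ (u v : V) → ∃ λ k → Walk A u v k

-- A cycle: distinct vertices x, x₁, …, x_r (r ≥ 2, i.e. at least 3 vertices),
-- consecutive ones adjacent, and the last one adjacent to x.
IsCycle : {V : Set} → (V → V → Set) → V → List V → Set
IsCycle A x xs = (2 ≤ length xs) × Unique (x ∷ xs) × Linked A (x ∷ xs ++ [ x ])

Acyclic : {V : Set} → (V → V → Set) → Set
Acyclic {V} A = ¬ (Σ V λ x → Σ (List V) λ xs → IsCycle A x xs)

IsTree : {V : Set} → (V → V → Set) → Set
IsTree A = IsSimpleGraph A × Connected A × Acyclic A

IsDistance : {V : Set} → (V → V → Set) → (V → V → ℕ) → Set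
IsDistance {V} A d = ∀ (u v : V) → Walk A u v (d u v) × (∀ k → Walk A u v k → d u v ≤ k)

pairSum : {V : Set} → (V → V → ℕ) → List V → ℕ
pairSum d []       = 0
pairSum d (x ∷ xs) = sum (map (d x) xs) + pairSum d xs

S : (n : ℕ) → (Fin n → Fin n → ℕ) → ℕ
S n d = pairSum d (allFin n)

-- m-vertex-operation graph: vertices are old vertices inj₁ u and pendant
-- vertices inj₂ (u , i), i < m, the i-th pendant vertex attached to u.
OpV : ℕ → ℕ → Set
OpV n m = Fin n ⊎ (Fin n × Fin m)

OpAdj : {n m : ℕ} → (Fin n → Fin n → Set) → OpV n m → OpV n m → Set
OpAdj A (inj₁ u)       (inj₁ v)       = A u v
OpAdj A (inj₁ u)       (inj₂ (w , _)) = u ≡ w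
OpAdj A (inj₂ (w , _)) (inj₁ u)       = w ≡ u
OpAdj A (inj₂ _)       (inj₂ _)       = ⊥

opVertices : (n m : ℕ) → List (OpV n m)
opVertices n m = map inj₁ (allFin n) ++ map inj₂ (cartesianProduct (allFin n) (allFin m))

S-op : (n m : ℕ) → (OpV n m → OpV n m → ℕ) → ℕ
S-op n m d' = pairSum d' (opVertices n m)

-- Write r(x) for the vertex of 𝒯 that x hangs on and δ(x) ∈ {0,1} for whether x
-- is a pendant vertex. A walk in 𝒯^⊙ between distinct vertices x, y projects to a
-- walk in 𝒯 from r(x) to r(y) that is shorter by at least δ(x) + δ(y), so
-- d^⊙(x, y) = d(r x, r y) + δ x + δ y. Summing over ordered pairs, each vertex of
-- 𝒯 is the root of 1 + m vertices and m|𝒱| vertices have δ = 1, which gives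
-- 2 𝒮^⊙ + 2m|𝒱| = (1 + m)² · 2𝒮 + 2 · m|𝒱| · (1 + m)|𝒱|.
module Submission where

open import Defs
open import Data.Nat using (ℕ; suc; _+_; _*_; _^_; _≤_; z≤n; s≤s)
open import Data.Nat.Properties
open import Algebra.Properties.CommutativeSemigroup +-commutativeSemigroup using (xy∙z≈xz∙y)
open import Data.Nat.ListAction using (sum)
open import Data.Nat.ListAction.Properties using (sum-++)
open import Data.Nat.Tactic.RingSolver using (solve-∀)
open import Data.Fin using (Fin)
open import Data.List using (List; []; _∷_; _++_; map; length; allFin; cartesianProduct)
open import Data.List.Properties using (map-++; map-∘; map-cong; length-tabulate)
open import Data.List.Relation.Unary.All using (All; []; _∷_)
open import Data.List.Relation.Unary.AllPairs using (_∷_)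
open import Data.List.Relation.Unary.Unique.Propositional using (Unique)
open import Data.List.Relation.Unary.Unique.Propositional.Properties
  using (map⁺; ++⁺; cartesianProduct⁺; allFin⁺)
open import Data.List.Membership.Propositional using (_∈_)
open import Data.List.Membership.Propositional.Properties using (∈-map⁻)
open import Data.Product using (_×_; _,_; ∃; proj₁; proj₂)
open import Data.Sum using (_⊎_; inj₁; inj₂)
open import Data.Empty using (⊥-elim)
open import Function using (_∘_)
open import Relation.Nullary using (¬_)
open import Relation.Binary.PropositionalEquality

private
  variable
    X Y : Set

∑ : List X → (X → ℕ) → ℕ
∑ xs f = sum (map f xs)

∑∑ : List X → (X → X → ℕ) → ℕ
∑∑ xs f = ∑ xs (λ x → ∑ xs (f x))

∑-++ : ∀ (xs ys : List X) f → ∑ (xs ++ ys) f ≡ ∑ xs f + ∑ ys f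
∑-++ xs ys f = trans (cong sum (map-++ f xs ys)) (sum-++ (map f xs) (map f ys))

∑-map : ∀ (g : Y → X) ys f → ∑ (map g ys) f ≡ ∑ ys (f ∘ g)
∑-map g ys f = cong sum (sym (map-∘ ys))

∑-cong : ∀ {f g : X → ℕ} → (∀ x → f x ≡ g x) → ∀ xs → ∑ xs f ≡ ∑ xs g
∑-cong f≗g xs = cong sum (map-cong f≗g xs)

∑-+ : ∀ (xs : List X) f g → ∑ xs (λ x → f x + g x) ≡ ∑ xs f + ∑ xs g
∑-+ []       f g = refl
∑-+ (x ∷ xs) f g = begin
  f x + g x + ∑ xs (λ x → f x + g x) ≡⟨ cong (f x + g x +_) (∑-+ xs f g) ⟩
  f x + g x + (∑ xs f + ∑ xs g)       ≡⟨ +-+-interchange (f x) (g x) _ _ ⟩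
  f x + ∑ xs f + (g x + ∑ xs g)       ∎
  where
  open ≡-Reasoning
  +-+-interchange : ∀ a b c e → a + b + (c + e) ≡ a + c + (b + e)
  +-+-interchange = solve-∀

∑-*ˡ : ∀ (xs : List X) c f → ∑ xs (λ x → c * f x) ≡ c * ∑ xs f
∑-*ˡ []       c f = sym (*-zeroʳ c)
∑-*ˡ (x ∷ xs) c f = trans (cong (c * f x +_) (∑-*ˡ xs c f)) (sym (*-distribˡ-+ c (f x) _))

∑-*ʳ : ∀ (xs : List X) c f → ∑ xs (λ x → f x * c) ≡ ∑ xs f * c
∑-*ʳ []       c f = refl
∑-*ʳ (x ∷ xs) c f = trans (cong (f x * c +_) (∑-*ʳ xs c f)) (sym (*-distribʳ-+ c (f x) _))

∑-const : ∀ (xs : List X) c → ∑ xs (λ _ → c) ≡ c * length xs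
∑-const []       c = sym (*-zeroʳ c)
∑-const (x ∷ xs) c = trans (cong (c +_) (∑-const xs c)) (sym (*-suc c (length xs)))

∑-cartesianProduct-proj₁ : ∀ (xs : List X) (ys : List Y) h →
  ∑ (cartesianProduct xs ys) (h ∘ proj₁) ≡ ∑ xs h * length ys
∑-cartesianProduct-proj₁ []       ys h = refl
∑-cartesianProduct-proj₁ (x ∷ xs) ys h = begin
  ∑ (map (x ,_) ys ++ cartesianProduct xs ys) (h ∘ proj₁)
    ≡⟨ ∑-++ (map (x ,_) ys) _ (h ∘ proj₁) ⟩
  ∑ (map (x ,_) ys) (h ∘ proj₁) + ∑ (cartesianProduct xs ys) (h ∘ proj₁)
    ≡⟨ cong₂ _+_ (trans (∑-map (x ,_) ys (h ∘ proj₁)) (∑-const ys (h x)))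
                 (∑-cartesianProduct-proj₁ xs ys h) ⟩
  h x * length ys + ∑ xs h * length ys
    ≡⟨ sym (*-distribʳ-+ (length ys) (h x) _) ⟩
  (h x + ∑ xs h) * length ys ∎
  where open ≡-Reasoning

∑∑-+-separable : ∀ (xs : List X) f a →
  ∑∑ xs (λ x y → f x y + a x + a y) ≡ ∑∑ xs f + ∑ xs a * length xs + ∑ xs a * length xs
∑∑-+-separable xs f a = begin
  ∑ xs (λ x → ∑ xs (λ y → f x y + a x + a y))
    ≡⟨ ∑-cong row xs ⟩
  ∑ xs (λ x → ∑ xs (f x) + a x * length xs + ∑ xs a)
    ≡⟨ ∑-+ xs (λ x → ∑ xs (f x) + a x * length xs) (λ _ → ∑ xs a) ⟩
  ∑ xs (λ x → ∑ xs (f x) + a x * length xs) + ∑ xs (λ _ → ∑ xs a)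
    ≡⟨ cong₂ _+_ (trans (∑-+ xs (λ x → ∑ xs (f x)) (λ x → a x * length xs))
                        (cong (∑∑ xs f +_) (∑-*ʳ xs (length xs) a)))
                 (∑-const xs (∑ xs a)) ⟩
  ∑∑ xs f + ∑ xs a * length xs + ∑ xs a * length xs ∎
  where
  open ≡-Reasoning
  row : ∀ x → ∑ xs (λ y → f x y + a x + a y) ≡ ∑ xs (f x) + a x * length xs + ∑ xs a
  row x = trans (∑-+ xs (λ y → f x y + a x) a)
                (cong (_+ ∑ xs a) (trans (∑-+ xs (f x) (λ _ → a x)) (cong (∑ xs (f x) +_) (∑-const xs (a x)))))

∑∑-pairSum : ∀ (f : X → X → ℕ) → (∀ x y → f x y ≡ f y x) → ∀ xs →
  ∑∑ xs f ≡ pairSum f xs + pairSum f xs + ∑ xs (λ x → f x x)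
∑∑-pairSum f f-sym []       = refl
∑∑-pairSum f f-sym (x ∷ xs) = begin
  f x x + ∑ xs (f x) + ∑ xs (λ z → f z x + ∑ xs (f z))
    ≡⟨ cong (f x x + r +_) (∑-+ xs (λ z → f z x) (λ z → ∑ xs (f z))) ⟩
  f x x + r + (∑ xs (λ z → f z x) + ∑∑ xs f)
    ≡⟨ cong₂ (λ c t → f x x + r + (c + t)) (∑-cong (λ z → f-sym z x) xs) (∑∑-pairSum f f-sym xs) ⟩
  f x x + r + (r + (P + P + diagonal))
    ≡⟨ regroup (f x x) r P diagonal ⟩
  (r + P) + (r + P) + (f x x + diagonal) ∎
  where
  open ≡-Reasoning
  r = ∑ xs (f x)
  P = pairSum f xs
  diagonal = ∑ xs (λ z → f z z)
  regroup : ∀ c r P D → c + r + (r + (P + P + D)) ≡ (r + P) + (r + P) + (c + D)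
  regroup = solve-∀

pairSum-cong : ∀ {f g : X → X → ℕ} (xs : List X) → Unique xs →
  (∀ x y → ¬ x ≡ y → f x y ≡ g x y) → pairSum f xs ≡ pairSum g xs
pairSum-cong                 []       _            f≗g = refl
pairSum-cong {f = f} {g = g} (x ∷ xs) (x∉xs ∷ !xs) f≗g =
  cong₂ _+_ (row xs x∉xs) (pairSum-cong xs !xs f≗g)
  where
  row : ∀ ys → All (λ y → ¬ x ≡ y) ys → ∑ ys (f x) ≡ ∑ ys (g x)
  row []       []          = refl
  row (y ∷ ys) (x≢y ∷ x∉ys) = cong₂ _+_ (f≗g x y x≢y) (row ys x∉ys)

module _ {V : Set} {A : V → V → Set} where

  snoc : ∀ {u w v k} → Walk A u w k → A w v → Walk A u v (suc k)
  snoc here       a = step a here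
  snoc (step b w) a = step b (snoc w a)

  reverse : (∀ u v → A u v → A v u) → ∀ {u v k} → Walk A u v k → Walk A v u k
  reverse A-sym here       = here
  reverse A-sym (step a w) = snoc (reverse A-sym w) (A-sym _ _ a)

  module _ {d : V → V → ℕ} (dist : IsDistance A d) where

    distance-refl : ∀ u → d u u ≡ 0
    distance-refl u = n≤0⇒n≡0 (proj₂ (dist u u) 0 here)

    distance-sym : (∀ u v → A u v → A v u) → ∀ u v → d u v ≡ d v u
    distance-sym A-sym u v = ≤-antisym (proj₂ (dist u v) _ (reverse A-sym (proj₁ (dist v u))))
                                       (proj₂ (dist v u) _ (reverse A-sym (proj₁ (dist u v))))

    distance-unique : ∀ {u v k} → Walk A u v k → (∀ j → Walk A u v j → k ≤ j) → d u v ≡ k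
    distance-unique w shortest = ≤-antisym (proj₂ (dist _ _) _ w) (shortest _ (proj₁ (dist _ _)))

root : ∀ {n m} → OpV n m → Fin n
root (inj₁ u)       = u
root (inj₂ (u , _)) = u

isPendant : ∀ {n m} → OpV n m → ℕ
isPendant (inj₁ _) = 0
isPendant (inj₂ _) = 1

pendantDistance : ∀ {n m} → (Fin n → Fin n → ℕ) → OpV n m → OpV n m → ℕ
pendantDistance d x y = d (root x) (root y) + isPendant x + isPendant y

module PendantWalks {n m : ℕ} (A : Fin n → Fin n → Set) where

  private
    A⊙ = OpAdj {n} {m} A

  RootWalk : OpV n m → OpV n m → ℕ → Set
  RootWalk x y k = ∃ λ j → Walk A (root x) (root y) j × j + isPendant x + isPendant y ≤ k

  lift : ∀ {u v k} → Walk A u v k → Walk A⊙ (inj₁ u) (inj₁ v) k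
  lift here       = here
  lift (step a w) = step a (lift w)

  lift-pendant : ∀ x y {k} → Walk A (root x) (root y) k → Walk A⊙ x y (k + isPendant x + isPendant y)
  lift-pendant (inj₁ _) (inj₁ _) {k} w =
    subst (Walk A⊙ _ _) (sym (trans (+-identityʳ _) (+-identityʳ k))) (lift w)
  lift-pendant (inj₁ _) (inj₂ _) {k} w =
    subst (Walk A⊙ _ _) (sym (trans (cong (_+ 1) (+-identityʳ k)) (+-comm k 1))) (snoc (lift w) refl)
  lift-pendant (inj₂ _) (inj₁ _) {k} w =
    subst (Walk A⊙ _ _) (sym (trans (+-identityʳ _) (+-comm k 1))) (step refl (lift w))
  lift-pendant (inj₂ _) (inj₂ _) {k} w =
    subst (Walk A⊙ _ _) (2+k≡k+1+1 k) (step refl (snoc (lift w) refl))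
    where
    2+k≡k+1+1 : ∀ k → suc (suc k) ≡ k + 1 + 1
    2+k≡k+1+1 = solve-∀

  edge-rootWalk : ∀ {x z} → A⊙ x z → RootWalk x z 1
  edge-rootWalk {inj₁ _}       {inj₁ _}       a    = 1 , step a here , ≤-refl
  edge-rootWalk {inj₁ _}       {inj₂ (_ , _)} refl = 0 , here , ≤-refl
  edge-rootWalk {inj₂ (_ , _)} {inj₁ _}       refl = 0 , here , ≤-refl

  step-rootWalk : ∀ {x z y k} → A⊙ x z → RootWalk z y k → RootWalk x y (suc k)
  step-rootWalk {inj₁ _}       {inj₁ _}       a    (j , w , le) = suc j , step a w , s≤s le
  step-rootWalk {inj₁ _}       {inj₂ (_ , _)} {y} {k} refl (j , w , le) =
    j , w , ≤-trans (+-monoˡ-≤ (isPendant y) (+-monoʳ-≤ j z≤n)) (≤-trans le (n≤1+n k))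
  step-rootWalk {inj₂ (_ , _)} {inj₁ _}       {y} {k} refl (j , w , le) =
    j , w , subst (_≤ suc k) (cong (_+ isPendant y) (sym (+-suc j 0))) (s≤s le)

  rootWalk : ∀ {x y k} → Walk A⊙ x y k → (x ≡ y × k ≡ 0) ⊎ RootWalk x y k
  rootWalk here = inj₁ (refl , refl)
  rootWalk (step a w) with rootWalk w
  ... | inj₁ (refl , refl) = inj₂ (edge-rootWalk a)
  ... | inj₂ r             = inj₂ (step-rootWalk a r)

  pendant-distance : ∀ {d d'} → IsDistance A d → IsDistance A⊙ d' →
    ∀ x y → ¬ x ≡ y → d' x y ≡ pendantDistance d x y
  pendant-distance {d} dist dist' x y x≢y =
    distance-unique dist' (lift-pendant x y (proj₁ (dist (root x) (root y)))) shortest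
    where
    shortest : ∀ k → Walk A⊙ x y k → pendantDistance d x y ≤ k
    shortest k w with rootWalk w
    ... | inj₁ (x≡y , _)   = ⊥-elim (x≢y x≡y)
    ... | inj₂ (j , w' , le) =
      ≤-trans (+-monoˡ-≤ (isPendant y) (+-monoˡ-≤ (isPendant x) (proj₂ (dist _ _) j w'))) le

private
  double-+ : ∀ a b → 2 * (a + b) ≡ a + a + (b + b)
  double-+ = solve-∀

  -- `_^_` is unfolded because the ring solver does not reflect it.
  pendant-polynomial : ∀ s k l → (1 + k) * ((1 + k) * (s + s)) + k * l * ((1 + k) * l) + k * l * ((1 + k) * l)
    ≡ 2 * ((1 + k) * ((1 + k) * 1) * s + k * (k + 1) * (l * (l * 1)))
  pendant-polynomial = solve-∀

length-allFin : ∀ k → length (allFin k) ≡ k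
length-allFin k = length-tabulate (λ i → i)

module PendantSums (n m : ℕ) where

  pendants : List (Fin n × Fin m)
  pendants = cartesianProduct (allFin n) (allFin m)

  vertices : List (OpV n m)
  vertices = opVertices n m

  vertices-unique : Unique vertices
  vertices-unique =
    ++⁺ (map⁺ inj₁-injective (allFin⁺ n))
        (map⁺ inj₂-injective (cartesianProduct⁺ (allFin⁺ n) (allFin⁺ m)))
        disjoint
    where
    inj₁-injective : ∀ {a b : Fin n} → _≡_ {A = OpV n m} (inj₁ a) (inj₁ b) → a ≡ b
    inj₁-injective refl = refl
    inj₂-injective : ∀ {a b : Fin n × Fin m} → _≡_ {A = OpV n m} (inj₂ a) (inj₂ b) → a ≡ b
    inj₂-injective refl = refl
    disjoint : ∀ {v} → ¬ (v ∈ map inj₁ (allFin n) × v ∈ map inj₂ pendants)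
    disjoint (v∈₁ , v∈₂) with ∈-map⁻ inj₁ v∈₁ | ∈-map⁻ inj₂ v∈₂
    ... | _ , _ , refl | _ , _ , ()

  ∑-root : ∀ h → ∑ vertices (h ∘ root) ≡ (1 + m) * ∑ (allFin n) h
  ∑-root h = begin
    ∑ (map inj₁ (allFin n) ++ map inj₂ pendants) (h ∘ root)
      ≡⟨ ∑-++ (map inj₁ (allFin n)) _ (h ∘ root) ⟩
    ∑ (map inj₁ (allFin n)) (h ∘ root) + ∑ (map inj₂ pendants) (h ∘ root)
      ≡⟨ cong₂ _+_ (∑-map inj₁ (allFin n) (h ∘ root))
                   (trans (∑-map inj₂ pendants (h ∘ root)) (∑-cartesianProduct-proj₁ (allFin n) (allFin m) h)) ⟩
    ∑ (allFin n) h + ∑ (allFin n) h * length (allFin m)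
      ≡⟨ cong (λ k → ∑ (allFin n) h + ∑ (allFin n) h * k) (length-allFin m) ⟩
    ∑ (allFin n) h + ∑ (allFin n) h * m
      ≡⟨ cong (∑ (allFin n) h +_) (*-comm (∑ (allFin n) h) m) ⟩
    (1 + m) * ∑ (allFin n) h ∎
    where open ≡-Reasoning

  ∑-isPendant : ∑ vertices isPendant ≡ m * n
  ∑-isPendant = begin
    ∑ (map inj₁ (allFin n) ++ map inj₂ pendants) isPendant
      ≡⟨ ∑-++ (map inj₁ (allFin n)) _ isPendant ⟩
    ∑ (map inj₁ (allFin n)) isPendant + ∑ (map inj₂ pendants) isPendant
      ≡⟨ cong₂ _+_ (trans (∑-map inj₁ (allFin n) isPendant) (∑-const (allFin n) 0))
                   (trans (∑-map inj₂ pendants isPendant) (∑-cartesianProduct-proj₁ (allFin n) (allFin m) (λ _ → 1))) ⟩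
    ∑ (allFin n) (λ _ → 1) * length (allFin m)
      ≡⟨ cong₂ _*_ (trans (∑-const (allFin n) 1) (trans (*-identityˡ _) (length-allFin n)))
                   (length-allFin m) ⟩
    n * m
      ≡⟨ *-comm n m ⟩
    m * n ∎
    where open ≡-Reasoning

  length-vertices : length vertices ≡ (1 + m) * n
  length-vertices = begin
    length vertices                 ≡⟨ sym (trans (∑-const vertices 1) (*-identityˡ _)) ⟩
    ∑ vertices (λ _ → 1)            ≡⟨ ∑-root (λ _ → 1) ⟩
    (1 + m) * ∑ (allFin n) (λ _ → 1) ≡⟨ cong ((1 + m) *_) (trans (∑-const (allFin n) 1) (*-identityˡ _)) ⟩
    (1 + m) * length (allFin n)     ≡⟨ cong ((1 + m) *_) (length-allFin n) ⟩
    (1 + m) * n                     ∎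
    where open ≡-Reasoning

  ∑∑-root : ∀ g → ∑∑ vertices (λ x y → g (root x) (root y)) ≡ (1 + m) * ((1 + m) * ∑∑ (allFin n) g)
  ∑∑-root g = begin
    ∑ vertices (λ x → ∑ vertices (g (root x) ∘ root))
      ≡⟨ ∑-cong (λ x → ∑-root (g (root x))) vertices ⟩
    ∑ vertices (λ x → (1 + m) * ∑ (allFin n) (g (root x)))
      ≡⟨ ∑-*ˡ vertices (1 + m) (λ x → ∑ (allFin n) (g (root x))) ⟩
    (1 + m) * ∑ vertices (λ x → ∑ (allFin n) (g (root x)))
      ≡⟨ cong ((1 + m) *_) (∑-root (λ u → ∑ (allFin n) (g u))) ⟩
    (1 + m) * ((1 + m) * ∑∑ (allFin n) g) ∎
    where open ≡-Reasoning

  pairSum-pendantDistance : ∀ (d : Fin n → Fin n → ℕ) → (∀ u v → d u v ≡ d v u) → (∀ u → d u u ≡ 0) →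
    2 * (pairSum (pendantDistance d) vertices + m * n) ≡ 2 * ((1 + m) ^ 2 * S n d + m * (m + 1) * n ^ 2)
  pairSum-pendantDistance d d-sym d-refl = begin
    2 * (P + m * n)
      ≡⟨ double-+ P (m * n) ⟩
    P + P + (m * n + m * n)
      ≡⟨ cong (P + P +_) (sym diagonal) ⟩
    P + P + ∑ vertices (λ x → D x x)
      ≡⟨ sym (∑∑-pairSum D D-sym vertices) ⟩
    ∑∑ vertices D
      ≡⟨ ∑∑-+-separable vertices (λ x y → d (root x) (root y)) isPendant ⟩
    ∑∑ vertices (λ x y → d (root x) (root y)) + ∑ vertices isPendant * length vertices
                                              + ∑ vertices isPendant * length vertices
      ≡⟨ cong₂ (λ t p → t + p + p) (∑∑-root d) (cong₂ _*_ ∑-isPendant length-vertices) ⟩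
    (1 + m) * ((1 + m) * ∑∑ (allFin n) d) + m * n * ((1 + m) * n) + m * n * ((1 + m) * n)
      ≡⟨ cong (λ t → (1 + m) * ((1 + m) * t) + m * n * ((1 + m) * n) + m * n * ((1 + m) * n)) ∑∑-d ⟩
    (1 + m) * ((1 + m) * (S n d + S n d)) + m * n * ((1 + m) * n) + m * n * ((1 + m) * n)
      ≡⟨ pendant-polynomial (S n d) m n ⟩
    2 * ((1 + m) ^ 2 * S n d + m * (m + 1) * n ^ 2) ∎
    where
    open ≡-Reasoning
    D = pendantDistance {n} {m} d
    P = pairSum D vertices

    D-sym : ∀ x y → D x y ≡ D y x
    D-sym x y = trans (cong (λ t → t + isPendant x + isPendant y) (d-sym (root x) (root y)))
                      (xy∙z≈xz∙y _ (isPendant x) (isPendant y))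

    diagonal : ∑ vertices (λ x → D x x) ≡ m * n + m * n
    diagonal = begin
      ∑ vertices (λ x → D x x)
        ≡⟨ ∑-cong (λ x → cong (λ t → t + isPendant x + isPendant x) (d-refl (root x))) vertices ⟩
      ∑ vertices (λ x → isPendant x + isPendant x)
        ≡⟨ ∑-+ vertices isPendant isPendant ⟩
      ∑ vertices isPendant + ∑ vertices isPendant
        ≡⟨ cong₂ _+_ ∑-isPendant ∑-isPendant ⟩
      m * n + m * n ∎

    ∑∑-d : ∑∑ (allFin n) d ≡ S n d + S n d
    ∑∑-d = trans (∑∑-pairSum d d-sym (allFin n))
                 (trans (cong (S n d + S n d +_) (trans (∑-cong d-refl (allFin n)) (∑-const (allFin n) 0)))
                        (+-identityʳ _))

theorem2 : (n m : ℕ) → 1 ≤ m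
         → (A : Fin n → Fin n → Set) → IsTree A
         → (d : Fin n → Fin n → ℕ) → IsDistance A d
         → (d' : OpV n m → OpV n m → ℕ) → IsDistance (OpAdj A) d'
         → S-op n m d' + m * n ≡ (1 + m) ^ 2 * S n d + m * (m + 1) * n ^ 2
theorem2 n m _ A ((A-sym , _) , _) d dist d' dist' = *-cancelˡ-≡ _ _ 2 (begin
  2 * (S-op n m d' + m * n)
    ≡⟨ cong (λ s → 2 * (s + m * n)) (pairSum-cong vertices vertices-unique (pendant-distance dist dist')) ⟩
  2 * (pairSum (pendantDistance d) vertices + m * n)
    ≡⟨ pairSum-pendantDistance d (distance-sym dist A-sym) (distance-refl dist) ⟩
  2 * ((1 + m) ^ 2 * S n d + m * (m + 1) * n ^ 2) ∎)
  where
  open ≡-Reasoning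
  open PendantWalks {n} {m} A
  open PendantSums n m
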